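{- Let $C_n$ be the cycle of order $n\ge 3$, $G_1,G_2$ disjoint copies of $C_n$, and $f_0:V(G_1)\to V(G_2)$ a constant function. Then $Z(C(C_n,f_0))=4$.
   Context: Zero forcing: color each vertex of a graph $H$ black or white, with $S$ the initial set of black vertices. The color-change rule turns a white vertex $u_2$ black if $u_2$ is the only white neighbor of some black vertex $u_1$. $S$ is a zero forcing set of $H$ if all vertices become black after finitely many applications of the rule. $Z(H)$ is the minimum size of a zero forcing set of $H$. Functigraph: given disjoint copies $G_1,G_2$ of $G$ and $f:V(G_1)\to V(G_2)$, $C(G,f)$ has vertex set $V(G_1)\cup V(G_2)$ and edge set $E(G_1)\cup E(G_2)\cup\{uv \mid v=f(u)\}$. -}

module Defs where

open import Data.Nat using (ℕ; zero; suc; _+_)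
open import Data.Fin using (Fin; toℕ; splitAt)
open import Data.Fin.Subset using (Subset; _∈_; ∣_∣)
open import Data.Sum using (_⊎_; inj₁; inj₂)
open import Data.Product using (_×_)
open import Relation.Binary.PropositionalEquality using (_≡_; _≢_)

record Graph (n : ℕ) : Set₁ where
  field
    Adj : Fin n → Fin n → Set

open Graph public

cycleAdj : (n : ℕ) → Fin n → Fin n → Set
cycleAdj n i j =
  (suc (toℕ i) ≡ toℕ j) ⊎ (suc (toℕ j) ≡ toℕ i)
  ⊎ ((toℕ i ≡ 0) × (suc (toℕ j) ≡ n)) ⊎ ((toℕ j ≡ 0) × (suc (toℕ i) ≡ n))

Cycle : (n : ℕ) → Graph n
Cycle n = record { Adj = cycleAdj n }

-- Functigraph C(G,f): vertices of G₁ are Fin n embedded on the left of Fin (n + n),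
-- vertices of G₂ on the right; edges E(G₁) ∪ E(G₂) ∪ {u v | v = f(u)}.
functiAdj : {n : ℕ} → Graph n → (Fin n → Fin n) → Fin (n + n) → Fin (n + n) → Set
functiAdj {n} G f x y with splitAt n x | splitAt n y
... | inj₁ a | inj₁ b = Adj G a b
... | inj₂ a | inj₂ b = Adj G a b
... | inj₁ a | inj₂ b = f a ≡ b
... | inj₂ b | inj₁ a = f a ≡ b

Functigraph : {n : ℕ} → Graph n → (Fin n → Fin n) → Graph (n + n)
Functigraph G f = record { Adj = functiAdj G f }

-- Vertices that are black after finitely many applications of the color-change
-- rule starting from the black set S: either initially black, or forced by a black
-- vertex u adjacent to v all of whose other neighbours are already black.
data Black {n : ℕ} (H : Graph n) (S : Subset n) : Fin n → Set where
  initial : ∀ {v} → v ∈ S → Black H S v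
  force   : ∀ {u v} → Black H S u → Adj H u v →
            (∀ w → Adj H u w → w ≢ v → Black H S w) → Black H S v

IsZeroForcingSet : {n : ℕ} → Graph n → Subset n → Set
IsZeroForcingSet {n} H S = ∀ (v : Fin n) → Black H S v

open import Data.Product using (Σ)
open import Data.Nat using (_≤_)

ZeroForcingNumberIs : {n : ℕ} → Graph n → ℕ → Set
ZeroForcingNumberIs {n} H k =
  (Σ (Subset n) λ S → IsZeroForcingSet H S × (∣ S ∣ ≡ k))
  × (∀ (S : Subset n) → IsZeroForcingSet H S → k ≤ ∣ S ∣)

-- Write v₁ and v₂ for the copies of a vertex v in G₁ and G₂; every vertex of G₁ is
-- joined to c₂. Upper bound: from {0₁, 1₁, 0₂, 1₂} the black vertices of G₂ force along
-- the cycle up to c₂ (no earlier vertex of G₂ has a neighbour in G₁), then G₁ forces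
-- along its cycle (the only outside neighbour of each of its vertices is c₂, already
-- black), and finally G₂ is completed. Lower bound: a zero forcing set has a member
-- outside every set that is closed under forcing. Applied to V(G₁) ∪ {c₂}, to V(G₂),
-- to V(G₂) ∪ {a₁} and to {a₁, a'₁, b₂} (with b ≠ c), this successively yields four
-- distinct members b₂, a₁, a'₁ and a fourth one.

module Submission where

open import Defs
open import Data.Nat using (ℕ; zero; suc; _+_; _≤_; _<_; z≤n; s≤s)
open import Data.Nat.Properties
  using (suc-injective; 1+n≢n; 0≢1+n; <⇒≢; ≤-trans; ≤-refl; ≤-reflexive; <⇒≤)
  renaming (_≟_ to _≟ℕ_)
open import Data.Fin
  using (Fin; toℕ; splitAt; _↑ˡ_; _↑ʳ_; fromℕ; inject₁; lower₁)
  renaming (zero to fz; suc to fs)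
open import Data.Fin.Properties
  using (toℕ-injective; toℕ-fromℕ; toℕ-inject₁; toℕ-lower₁; toℕ<n;
         splitAt-↑ˡ; splitAt-↑ʳ; join-splitAt; ↑ˡ-injective; ↑ʳ-injective)
  renaming (_≟_ to _≟ᶠ_)
open import Data.Fin.Subset using (Subset; _∈_; ∣_∣; _-_; inside; outside) renaming (⊥ to ∅)
open import Data.Fin.Subset.Properties using (∣⊥∣≡0; x∈p∧x≢y⇒x∈p-y; x∈p⇒∣p-x∣<∣p∣)
open import Data.List using (List; []; _∷_; length)
open import Data.List.Relation.Unary.All as All using (All; []; _∷_)
open import Data.List.Relation.Unary.Unique.Propositional using (Unique; []; _∷_)
open import Data.Vec using (_∷_; []; _++_)
open import Data.Vec.Base using (here; there)
open import Data.Sum using (_⊎_; inj₁; inj₂; [_,_]; [_,_]′)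
open import Data.Product using (_×_; _,_; ∃-syntax; ∃₂)
open import Data.Unit using (⊤; tt)
open import Data.Empty using (⊥)
open import Function using (_∘_; id; const; _⇔_; mk⇔; Equivalence)
open import Relation.Nullary using (¬_; Dec; yes; no; contradiction; _⊎-dec_)
open import Relation.Unary using (Decidable)
open import Relation.Binary.PropositionalEquality using (_≡_; _≢_; refl; sym; trans; cong; cong₂; subst)

open Equivalence using (to; from)

distinct-members-bound : ∀ {m} {p : Subset m} {xs : List (Fin m)} →
  Unique xs → All (_∈ p) xs → length xs ≤ ∣ p ∣
distinct-members-bound [] [] = z≤n
distinct-members-bound {p = p} (x∉xs ∷ unique) (x∈p ∷ xs⊆p) =
  ≤-trans (s≤s (distinct-members-bound unique (All.zipWith in-p-x (xs⊆p , x∉xs))))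
          (x∈p⇒∣p-x∣<∣p∣ x∈p)
  where
  in-p-x : ∀ {y x} → y ∈ p × x ≢ y → y ∈ p - x
  in-p-x (y∈p , x≢y) = x∈p∧x≢y⇒x∈p-y y∈p (x≢y ∘ sym)

∣p++q∣≡∣p∣+∣q∣ : ∀ {m n} (p : Subset m) (q : Subset n) → ∣ p ++ q ∣ ≡ ∣ p ∣ + ∣ q ∣
∣p++q∣≡∣p∣+∣q∣ []            q = refl
∣p++q∣≡∣p∣+∣q∣ (inside  ∷ p) q = cong suc (∣p++q∣≡∣p∣+∣q∣ p q)
∣p++q∣≡∣p∣+∣q∣ (outside ∷ p) q = ∣p++q∣≡∣p∣+∣q∣ p q

∈-++⁺ʳ : ∀ {m n} (p : Subset m) {q : Subset n} {j} → j ∈ q → m ↑ʳ j ∈ p ++ q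
∈-++⁺ʳ []      j∈q = j∈q
∈-++⁺ʳ (_ ∷ p) j∈q = there (∈-++⁺ʳ p j∈q)

module _ {n : ℕ} where

  private
    3≤n⇒n≢1 : 3 ≤ n → n ≢ 1
    3≤n⇒n≢1 (s≤s ()) refl

  cycleAdj⇒≢ : 3 ≤ n → {x y : Fin n} → cycleAdj n x y → x ≢ y
  cycleAdj⇒≢ _ (inj₁ e) refl = 1+n≢n e
  cycleAdj⇒≢ _ (inj₂ (inj₁ e)) refl = 1+n≢n e
  cycleAdj⇒≢ 3≤n (inj₂ (inj₂ (inj₁ (x≡0 , e)))) refl =
    3≤n⇒n≢1 3≤n (trans (sym e) (cong suc x≡0))
  cycleAdj⇒≢ 3≤n (inj₂ (inj₂ (inj₂ (x≡0 , e)))) refl =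
    3≤n⇒n≢1 3≤n (trans (sym e) (cong suc x≡0))

  cycleAdj-interior : {i j k y : Fin n} → toℕ j ≡ suc (toℕ i) → toℕ k ≡ suc (toℕ j) →
                      cycleAdj n j y → y ≡ i ⊎ y ≡ k
  cycleAdj-interior j≡1+i k≡1+j (inj₁ e) = inj₂ (toℕ-injective (trans (sym e) (sym k≡1+j)))
  cycleAdj-interior j≡1+i k≡1+j (inj₂ (inj₁ e)) = inj₁ (toℕ-injective (suc-injective (trans e j≡1+i)))
  cycleAdj-interior j≡1+i k≡1+j (inj₂ (inj₂ (inj₁ (j≡0 , _)))) =
    contradiction (trans (sym j≡0) j≡1+i) 0≢1+n
  cycleAdj-interior {k = k} j≡1+i k≡1+j (inj₂ (inj₂ (inj₂ (_ , e)))) =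
    contradiction (trans k≡1+j e) (<⇒≢ (toℕ<n k))

  cycleAdj-two-neighbours : 3 ≤ n → (x : Fin n) →
                            ∃₂ λ y z → cycleAdj n x y × cycleAdj n x z × y ≢ z
  cycleAdj-two-neighbours (s≤s (s≤s (s≤s {n = k} _))) fz =
    fs fz , fromℕ (suc (suc k)) ,
    inj₁ refl , inj₂ (inj₂ (inj₁ (refl , cong suc (toℕ-fromℕ (suc (suc k)))))) , λ ()
  cycleAdj-two-neighbours (s≤s (s≤s (s≤s {n = k} _))) (fs x) with suc k ≟ℕ toℕ x
  ... | no x≢last =
    inject₁ x , fs (fs (lower₁ x x≢last)) , inj₂ (inj₁ (cong suc (toℕ-inject₁ x))) ,
    inj₁ (cong (suc ∘ suc) (sym (toℕ-lower₁ x x≢last))) ,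
    λ e → m≢2+m (trans (sym (toℕ-inject₁ x))
                       (trans (cong toℕ e) (cong (suc ∘ suc) (toℕ-lower₁ x x≢last))))
    where
    m≢2+m : ∀ {m} → m ≢ suc (suc m)
    m≢2+m {suc m} e = m≢2+m (suc-injective e)
  ... | yes x≡last =
    inject₁ x , fz , inj₂ (inj₁ (cong suc (toℕ-inject₁ x))) ,
    inj₂ (inj₂ (inj₂ (refl , cong (suc ∘ suc) (sym x≡last)))) ,
    λ e → 0≢1+n (trans (sym (cong toℕ e)) (trans (toℕ-inject₁ x) (sym x≡last)))

  cycle-other-neighbour : 3 ≤ n → (x y : Fin n) → ∃[ z ] cycleAdj n x z × z ≢ y × z ≢ x
  cycle-other-neighbour 3≤n x y with cycleAdj-two-neighbours 3≤n x
  ... | z₁ , z₂ , x~z₁ , x~z₂ , z₁≢z₂ with z₁ ≟ᶠ y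
  ...   | yes refl = z₂ , x~z₂ , z₁≢z₂ ∘ sym , cycleAdj⇒≢ 3≤n x~z₂ ∘ sym
  ...   | no z₁≢y  = z₁ , x~z₁ , z₁≢y , cycleAdj⇒≢ 3≤n x~z₁ ∘ sym

  ∃-≢-both : 3 ≤ n → (x y : Fin n) → ∃[ z ] z ≢ x × z ≢ y
  ∃-≢-both 3≤n x y = let z , _ , z≢y , z≢x = cycle-other-neighbour 3≤n x y in z , z≢x , z≢y

Consecutive : ∀ {m} → Fin m → Fin m → Fin m → Set
Consecutive i j k = toℕ j ≡ suc (toℕ i) × toℕ k ≡ suc (toℕ j)

sweep : ∀ {m} (P : Fin (suc (suc m)) → Set) → P fz → P (fs fz) →
        (∀ {i j k} → Consecutive i j k → P i → P j → P k) → ∀ i → P i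
sweep P P0 P1 step i = at (toℕ i) refl
  where
  at : ∀ t {i} → toℕ i ≡ t → P i
  at zero          {fz}         _ = P0
  at (suc zero)    {fs fz}      _ = P1
  at (suc (suc t)) {fs (fs x)} refl =
    step {inject₁ (inject₁ x)} {fs (inject₁ x)}
         (cong suc (sym (toℕ-inject₁ (inject₁ x))) , cong (suc ∘ suc) (sym (toℕ-inject₁ x)))
         (at t (trans (toℕ-inject₁ (inject₁ x)) (toℕ-inject₁ x)))
         (at (suc t) (cong suc (toℕ-inject₁ x)))

-- The complements of forcing-closed sets are the forts of Fast and Hicks.
IsForcingClosed : ∀ {m} → Graph m → (Fin m → Set) → Set
IsForcingClosed H T =
  ∀ {u v} → T u → Adj H u v → ¬ T v → ∃[ w ] Adj H u w × w ≢ v × ¬ T w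

module _ {m} {H : Graph m} {S : Subset m} {T : Fin m → Set}
         (T? : Decidable T) (closed : IsForcingClosed H T) where

  Black-escapes : ∀ {v} → Black H S v → ¬ T v → ∃[ x ] x ∈ S × ¬ T x
  Black-escapes (initial v∈S) ¬Tv = _ , v∈S , ¬Tv
  Black-escapes (force {u} black-u u~v others-black) ¬Tv with T? u
  ... | no ¬Tu = Black-escapes black-u ¬Tu
  ... | yes Tu = let w , u~w , w≢v , ¬Tw = closed Tu u~v ¬Tv in
                 Black-escapes (others-black w u~w w≢v) ¬Tw

  zero-forcing-escapes : IsZeroForcingSet H S → ∀ {v} → ¬ T v → ∃[ x ] x ∈ S × ¬ T x
  zero-forcing-escapes zfs {v} = Black-escapes (zfs v)

module _ {n : ℕ} where

  data Copy : Fin (n + n) → Set where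
    copy₁ : (i : Fin n) → Copy (i ↑ˡ n)
    copy₂ : (j : Fin n) → Copy (n ↑ʳ j)

  copy : (x : Fin (n + n)) → Copy x
  copy x = subst Copy (join-splitAt n n x) (from-split (splitAt n x))
    where
    from-split : (s : Fin n ⊎ Fin n) → Copy ([ _↑ˡ n , n ↑ʳ_ ]′ s)
    from-split (inj₁ i) = copy₁ i
    from-split (inj₂ j) = copy₂ j

  ↑ˡ≢↑ʳ : {i j : Fin n} → i ↑ˡ n ≢ n ↑ʳ j
  ↑ˡ≢↑ʳ {i} {j} e =
    contradiction (trans (sym (splitAt-↑ˡ n i n)) (trans (cong (splitAt n) e) (splitAt-↑ʳ n n j))) λ ()

  OnCopies : (Fin n → Set) → (Fin n → Set) → Fin (n + n) → Set
  OnCopies P Q x = [ P , Q ]′ (splitAt n x)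

module FunctigraphAdjacency {n : ℕ} (G : Graph n) (f : Fin n → Fin n) where

  private
    H : Graph (n + n)
    H = Functigraph G f

  adj-↑ˡ↑ˡ : (i j : Fin n) → Adj H (i ↑ˡ n) (j ↑ˡ n) ⇔ Adj G i j
  adj-↑ˡ↑ˡ i j rewrite splitAt-↑ˡ n i n | splitAt-↑ˡ n j n = mk⇔ id id

  adj-↑ʳ↑ʳ : (i j : Fin n) → Adj H (n ↑ʳ i) (n ↑ʳ j) ⇔ Adj G i j
  adj-↑ʳ↑ʳ i j rewrite splitAt-↑ʳ n n i | splitAt-↑ʳ n n j = mk⇔ id id

  adj-↑ˡ↑ʳ : (i j : Fin n) → Adj H (i ↑ˡ n) (n ↑ʳ j) ⇔ f i ≡ j
  adj-↑ˡ↑ʳ i j rewrite splitAt-↑ˡ n i n | splitAt-↑ʳ n n j = mk⇔ id id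

  adj-↑ʳ↑ˡ : (j i : Fin n) → Adj H (n ↑ʳ j) (i ↑ˡ n) ⇔ f i ≡ j
  adj-↑ʳ↑ˡ j i rewrite splitAt-↑ˡ n i n | splitAt-↑ʳ n n j = mk⇔ id id

module OnCopiesProperties {n : ℕ} (P Q : Fin n → Set) where

  ↑ˡ⇔ : {i : Fin n} → OnCopies P Q (i ↑ˡ n) ⇔ P i
  ↑ˡ⇔ {i} rewrite splitAt-↑ˡ n i n = mk⇔ id id

  ↑ʳ⇔ : {j : Fin n} → OnCopies P Q (n ↑ʳ j) ⇔ Q j
  ↑ʳ⇔ {j} rewrite splitAt-↑ʳ n n j = mk⇔ id id

  onCopies? : Decidable P → Decidable Q → Decidable (OnCopies P Q)
  onCopies? P? Q? x = [_,_] {C = λ s → Dec ([ P , Q ]′ s)} P? Q? (splitAt n x)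

  module _ (P? : Decidable P) (Q? : Decidable Q) {H : Graph (n + n)} {S : Subset (n + n)}
           (closed : IsForcingClosed H (OnCopies P Q)) (zfs : IsZeroForcingSet H S) where

    zero-forcing-escapes-on-copies : ∀ {v} → ¬ OnCopies P Q v →
      (∃[ i ] i ↑ˡ n ∈ S × ¬ P i) ⊎ (∃[ j ] n ↑ʳ j ∈ S × ¬ Q j)
    zero-forcing-escapes-on-copies ¬Tv
      with zero-forcing-escapes (onCopies? P? Q?) closed zfs ¬Tv
    ... | x , x∈S , ¬Tx with copy {n} x
    ...   | copy₁ i = inj₁ (i , x∈S , ¬Tx ∘ from ↑ˡ⇔)
    ...   | copy₂ j = inj₂ (j , x∈S , ¬Tx ∘ from ↑ʳ⇔)

module _ {n : ℕ} (f : Fin n → Fin n) {S : Subset (n + n)} where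

  private
    H : Graph (n + n)
    H = Functigraph (Cycle n) f
    B : Fin (n + n) → Set
    B = Black H S

  open FunctigraphAdjacency (Cycle n) f

  force-along-copy₁ : ∀ {i j k} → Consecutive i j k →
    B (i ↑ˡ n) → B (j ↑ˡ n) → B (n ↑ʳ f j) → B (k ↑ˡ n)
  force-along-copy₁ {i} {j} {k} (j≡1+i , k≡1+j) black-i black-j black-fj =
    force black-j (from (adj-↑ˡ↑ˡ j k) (inj₁ (sym k≡1+j))) others
    where
    others : ∀ w → Adj H (j ↑ˡ n) w → w ≢ k ↑ˡ n → B w
    others w j~w w≢k with copy {n} w
    ... | copy₂ y = subst (B ∘ (n ↑ʳ_)) (to (adj-↑ˡ↑ʳ j y) j~w) black-fj
    ... | copy₁ y with cycleAdj-interior j≡1+i k≡1+j (to (adj-↑ˡ↑ˡ j y) j~w)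
    ...   | inj₁ refl = black-i
    ...   | inj₂ refl = contradiction refl w≢k

  force-along-copy₂ : ∀ {i j k} → Consecutive i j k →
    B (n ↑ʳ i) → B (n ↑ʳ j) → (∀ l → f l ≡ j → B (l ↑ˡ n)) → B (n ↑ʳ k)
  force-along-copy₂ {i} {j} {k} (j≡1+i , k≡1+j) black-i black-j black-preimage =
    force black-j (from (adj-↑ʳ↑ʳ j k) (inj₁ (sym k≡1+j))) others
    where
    others : ∀ w → Adj H (n ↑ʳ j) w → w ≢ n ↑ʳ k → B w
    others w j~w w≢k with copy {n} w
    ... | copy₁ y = black-preimage y (to (adj-↑ʳ↑ˡ j y) j~w)
    ... | copy₂ y with cycleAdj-interior j≡1+i k≡1+j (to (adj-↑ʳ↑ʳ j y) j~w)
    ...   | inj₁ refl = black-i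
    ...   | inj₂ refl = contradiction refl w≢k

⁅0,1⁆ : ∀ {m} → Subset (suc (suc m))
⁅0,1⁆ = inside ∷ inside ∷ ∅

∣⁅0,1⁆∣≡2 : ∀ m → ∣ ⁅0,1⁆ {m} ∣ ≡ 2
∣⁅0,1⁆∣≡2 m = cong (suc ∘ suc) (∣⊥∣≡0 m)

∣⁅0,1⁆++⁅0,1⁆∣≡4 : ∀ m → ∣ ⁅0,1⁆ {m} ++ ⁅0,1⁆ {m} ∣ ≡ 4
∣⁅0,1⁆++⁅0,1⁆∣≡4 m =
  trans (∣p++q∣≡∣p∣+∣q∣ (⁅0,1⁆ {m}) ⁅0,1⁆) (cong₂ _+_ (∣⁅0,1⁆∣≡2 m) (∣⁅0,1⁆∣≡2 m))

module _ {m : ℕ} (c : Fin (suc (suc m))) where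

  private
    n : ℕ
    n = suc (suc m)
    S : Subset (n + n)
    S = ⁅0,1⁆ ++ ⁅0,1⁆
    B : Fin (n + n) → Set
    B = Black (Functigraph (Cycle n) (const c)) S
    0₂∈S : n ↑ʳ fz ∈ S
    0₂∈S = ∈-++⁺ʳ ⁅0,1⁆ here
    1₂∈S : n ↑ʳ fs fz ∈ S
    1₂∈S = ∈-++⁺ʳ ⁅0,1⁆ (there here)

  -- Before c₂ no vertex of G₂ has a neighbour in G₁, so G₂ forces along its cycle unaided.
  copy₂-black-up-to-c : ∀ j → toℕ j ≤ toℕ c → B (n ↑ʳ j)
  copy₂-black-up-to-c =
    sweep _ (λ _ → initial 0₂∈S) (λ _ → initial 1₂∈S) step
    where
    step : ∀ {i j k} → Consecutive i j k →
           (toℕ i ≤ toℕ c → B (n ↑ʳ i)) → (toℕ j ≤ toℕ c → B (n ↑ʳ j)) →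
           toℕ k ≤ toℕ c → B (n ↑ʳ k)
    step {i} {j} (j≡1+i , k≡1+j) black-i black-j k≤c =
      force-along-copy₂ (const c) (j≡1+i , k≡1+j) (black-i (<⇒≤ i<c)) (black-j (<⇒≤ j<c))
        (λ _ c≡j → contradiction (cong toℕ (sym c≡j)) (<⇒≢ j<c))
      where
      j<c : toℕ j < toℕ c
      j<c = ≤-trans (≤-reflexive (sym k≡1+j)) k≤c
      i<c : toℕ i < toℕ c
      i<c = ≤-trans (≤-reflexive (sym j≡1+i)) (<⇒≤ j<c)

  copy₂-black-c : B (n ↑ʳ c)
  copy₂-black-c = copy₂-black-up-to-c c ≤-refl

  copy₁-black : ∀ i → B (i ↑ˡ n)
  copy₁-black = sweep _ (initial here) (initial (there here)) λ consecutive black-i black-j →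
    force-along-copy₁ (const c) consecutive black-i black-j copy₂-black-c

  copy₂-black : ∀ j → B (n ↑ʳ j)
  copy₂-black = sweep _ (initial 0₂∈S) (initial 1₂∈S) λ consecutive black-i black-j →
    force-along-copy₂ (const c) consecutive black-i black-j (λ l _ → copy₁-black l)

  ⁅0,1⁆++⁅0,1⁆-zero-forcing : IsZeroForcingSet (Functigraph (Cycle n) (const c)) S
  ⁅0,1⁆++⁅0,1⁆-zero-forcing x with copy {n} x
  ... | copy₁ i = copy₁-black i
  ... | copy₂ j = copy₂-black j

module _ {n : ℕ} (3≤n : 3 ≤ n) (c : Fin n) where

  private
    H : Graph (n + n)
    H = Functigraph (Cycle n) (const c)

  open FunctigraphAdjacency (Cycle n) (const c)

  module _ {S : Subset (n + n)} (zfs : IsZeroForcingSet H S) where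

    ∃-copy₂-member≢c : ∃[ b ] n ↑ʳ b ∈ S × b ≢ c
    ∃-copy₂-member≢c =
      let _ , z≢c , _ = ∃-≢-both 3≤n c c in
      [ (λ (_ , _ , ¬⊤) → contradiction tt ¬⊤) , id ]′
        (zero-forcing-escapes-on-copies (λ _ → yes tt) (_≟ᶠ c) closed zfs (z≢c ∘ to ↑ʳ⇔))
      where
      open OnCopiesProperties (const ⊤) (_≡ c)
      closed : IsForcingClosed H (OnCopies (const ⊤) (_≡ c))
      closed {u} {v} Tu u~v ¬Tv with copy {n} u | copy {n} v
      ... | _ | copy₁ i = contradiction (from ↑ˡ⇔ tt) ¬Tv
      ... | copy₁ k | copy₂ j = contradiction (from ↑ʳ⇔ (sym (to (adj-↑ˡ↑ʳ k j) u~v))) ¬Tv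
      ... | copy₂ k | copy₂ j =
        let z , k~z , z≢j , z≢k = cycle-other-neighbour 3≤n k j in
        n ↑ʳ z , from (adj-↑ʳ↑ʳ k z) k~z , z≢j ∘ ↑ʳ-injective n z j ,
        λ Tz → z≢k (trans (to ↑ʳ⇔ Tz) (sym (to ↑ʳ⇔ Tu)))

    ∃-copy₁-member : ∃[ a ] a ↑ˡ n ∈ S
    ∃-copy₁-member =
      [ (λ (a , a∈S , _) → a , a∈S) , (λ (_ , _ , ¬⊤) → contradiction tt ¬⊤) ]′
        (zero-forcing-escapes-on-copies (λ _ → no id) (λ _ → yes tt) closed zfs (to (↑ˡ⇔ {c})))
      where
      open OnCopiesProperties {n} (const ⊥) (const ⊤)
      closed : IsForcingClosed H (OnCopies {n} (const ⊥) (const ⊤))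
      closed {u} {v} Tu u~v ¬Tv with copy {n} u | copy {n} v
      ... | _ | copy₂ j = contradiction (from ↑ʳ⇔ tt) ¬Tv
      ... | copy₁ k | copy₁ i = contradiction (to ↑ˡ⇔ Tu) id
      ... | copy₂ k | copy₁ i =
        let z , z≢i , _ = ∃-≢-both 3≤n i i in
        z ↑ˡ n , from (adj-↑ʳ↑ˡ k z) (to (adj-↑ʳ↑ˡ k i) u~v) , z≢i ∘ ↑ˡ-injective n z i ,
        to ↑ˡ⇔

    ∃-copy₁-member≢ : (a : Fin n) → ∃[ a' ] a' ↑ˡ n ∈ S × a' ≢ a
    ∃-copy₁-member≢ a =
      let _ , z≢a , _ = ∃-≢-both 3≤n a a in
      [ id , (λ (_ , _ , ¬⊤) → contradiction tt ¬⊤) ]′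
        (zero-forcing-escapes-on-copies (_≟ᶠ a) (λ _ → yes tt) closed zfs (z≢a ∘ to ↑ˡ⇔))
      where
      open OnCopiesProperties (_≡ a) (const ⊤)
      closed : IsForcingClosed H (OnCopies (_≡ a) (const ⊤))
      closed {u} {v} Tu u~v ¬Tv with copy {n} u | copy {n} v
      ... | _ | copy₂ j = contradiction (from ↑ʳ⇔ tt) ¬Tv
      ... | copy₂ k | copy₁ i =
        let z , z≢i , z≢a = ∃-≢-both 3≤n i a in
        z ↑ˡ n , from (adj-↑ʳ↑ˡ k z) (to (adj-↑ʳ↑ˡ k i) u~v) , z≢i ∘ ↑ˡ-injective n z i ,
        z≢a ∘ to ↑ˡ⇔
      ... | copy₁ k | copy₁ i =
        let z , k~z , z≢i , z≢k = cycle-other-neighbour 3≤n k i in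
        z ↑ˡ n , from (adj-↑ˡ↑ˡ k z) k~z , z≢i ∘ ↑ˡ-injective n z i ,
        λ Tz → z≢k (trans (to ↑ˡ⇔ Tz) (sym (to ↑ˡ⇔ Tu)))

    ∃-member-outside : (a a' b : Fin n) → b ≢ c →
      ∃[ x ] x ∈ S × x ≢ a ↑ˡ n × x ≢ a' ↑ˡ n × x ≢ n ↑ʳ b
    ∃-member-outside a a' b b≢c =
      let x , x∈S , ¬Tx = zero-forcing-escapes (onCopies? (λ i → i ≟ᶠ a ⊎-dec i ≟ᶠ a') (_≟ᶠ b))
                                               closed zfs (b≢c ∘ sym ∘ to ↑ʳ⇔) in
      x , x∈S , distinct ¬Tx (from ↑ˡ⇔ (inj₁ refl)) , distinct ¬Tx (from ↑ˡ⇔ (inj₂ refl)) ,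
      distinct ¬Tx (from ↑ʳ⇔ refl)
      where
      P : Fin n → Set
      P i = i ≡ a ⊎ i ≡ a'
      T : Fin (n + n) → Set
      T = OnCopies P (_≡ b)
      open OnCopiesProperties P (_≡ b)
      distinct : ∀ {x y} → ¬ T x → T y → x ≢ y
      distinct ¬Tx Ty refl = ¬Tx Ty
      closed : IsForcingClosed H T
      closed {u} {v} Tu u~v ¬Tv with copy {n} u | copy {n} v
      ... | copy₁ k | copy₁ i =
        n ↑ʳ c , from (adj-↑ˡ↑ʳ k c) refl , ↑ˡ≢↑ʳ ∘ sym , b≢c ∘ sym ∘ to ↑ʳ⇔
      ... | copy₂ k | copy₁ i =
        contradiction (trans (sym (to ↑ʳ⇔ Tu)) (sym (to (adj-↑ʳ↑ˡ k i) u~v))) b≢c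
      ... | copy₂ k | copy₂ j =
        let z , k~z , z≢j , z≢k = cycle-other-neighbour 3≤n k j in
        n ↑ʳ z , from (adj-↑ʳ↑ʳ k z) k~z , z≢j ∘ ↑ʳ-injective n z j ,
        λ Tz → z≢k (trans (to ↑ʳ⇔ Tz) (sym (to ↑ʳ⇔ Tu)))
      ... | copy₁ k | copy₂ j with to ↑ˡ⇔ Tu
      ...   | inj₁ refl =
        let z , a~z , z≢a' , z≢a = cycle-other-neighbour 3≤n a a' in
        z ↑ˡ n , from (adj-↑ˡ↑ˡ a z) a~z , ↑ˡ≢↑ʳ , [ z≢a , z≢a' ]′ ∘ to ↑ˡ⇔
      ...   | inj₂ refl =
        let z , a'~z , z≢a , z≢a' = cycle-other-neighbour 3≤n a' a in
        z ↑ˡ n , from (adj-↑ˡ↑ˡ a' z) a'~z , ↑ˡ≢↑ʳ , [ z≢a , z≢a' ]′ ∘ to ↑ˡ⇔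

    zero-forcing⇒4≤∣S∣ : 4 ≤ ∣ S ∣
    zero-forcing⇒4≤∣S∣ =
      let b , b∈S , b≢c = ∃-copy₂-member≢c
          a , a∈S = ∃-copy₁-member
          a' , a'∈S , a'≢a = ∃-copy₁-member≢ a
          x , x∈S , x≢a , x≢a' , x≢b = ∃-member-outside a a' b b≢c
      in distinct-members-bound
           ((a'≢a ∘ sym ∘ ↑ˡ-injective n a a' ∷ ↑ˡ≢↑ʳ ∷ x≢a ∘ sym ∷ [])
            ∷ (↑ˡ≢↑ʳ ∷ x≢a' ∘ sym ∷ [])
            ∷ (x≢b ∘ sym ∷ [])
            ∷ [] ∷ [])
           (a∈S ∷ a'∈S ∷ b∈S ∷ x∈S ∷ [])

proposition5p7 : (n : ℕ) → 3 ≤ n → (c : Fin n) →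
    ZeroForcingNumberIs (Functigraph (Cycle n) (λ _ → c)) 4
proposition5p7 _ 3≤n@(s≤s (s≤s {n = m} _)) c =
  (⁅0,1⁆ ++ ⁅0,1⁆ , ⁅0,1⁆++⁅0,1⁆-zero-forcing c , ∣⁅0,1⁆++⁅0,1⁆∣≡4 m) ,
  λ _ → zero-forcing⇒4≤∣S∣ 3≤n c
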